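{- Let $T:\mathbb{M}\to\mathbb{T}$ and $T':\mathbb{M}\to\mathbb{T}'$ be second-order algebraic theories and $F:\mathbb{T}\to\mathbb{T}'$ an algebraic translation from $T$ to $T'$. Then the algebraic functor $\mathrm{FunMod}(T',\mathrm{Set})\to\mathrm{FunMod}(T,\mathrm{Set})$, $S\mapsto S\circ F$, has a left adjoint.
   Context: $\mathbb{M}$: objects are finite sequences $\langle m_1,\dots,m_k\rangle\in\mathbb{N}^*$; a morphism $\langle m_1,\dots,m_k\rangle\to\langle n_1,\dots,n_\ell\rangle$ is a tuple $\langle t_1,\dots,t_\ell\rangle$ where $t_i$ is a second-order term with no operators in context $\mathsf{m}_1:[m_1],\dots,\mathsf{m}_k:[m_k]\rhd x_1,\dots,x_{n_i}$, i.e. generated by variables $x_j$ and metavariable applications $\mathsf{m}_i[s_1,\dots,s_{m_i}]$; identities are $\langle\mathsf{m}_i[x_1,\dots,x_{m_i}]\rangle_i$ and the composite of $\langle s_p\rangle_{p\le j}:\langle l_1,\dots,l_i\rangle\to\langle m_1,\dots,m_j\rangle$ then $\langle t_q\rangle_q$ is $\langle t_q\{\mathsf{m}_p:=(x_1,\dots,x_{m_p})s_p\}_p\rangle_q$, where metasubstitution replaces each $\mathsf{m}_p[u_1,\dots,u_{m_p}]$ by $s_p$ with $x_r$ substituted by the (metasubstituted) $u_r$. $\mathbb{M}$ is strict cartesian (products by concatenation) and $\langle0\rangle$ is exponentiable with $\langle0\rangle\Rightarrow\langle m_1,\dots,m_k\rangle=\langle m_1+1,\dots,m_k+1\rangle$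 and evaluation $\langle\mathsf{m}_i[x_1,\dots,x_{m_i},\mathsf{m}_{k+1}[\,]]\rangle_{i\le k}$. A second-order algebraic theory is a cartesian category $\mathbb{T}$ with a strict cartesian identity-on-objects functor $T:\mathbb{M}\to\mathbb{T}$ preserving the exponentiable object $\langle0\rangle$. An algebraic translation $T\to T'$ is a functor $F:\mathbb{T}\to\mathbb{T}'$ with $T'=F\circ T$. $\mathrm{FunMod}(T,\mathrm{Set})$ is the category of cartesian (finite-product-preserving) functors $\mathbb{T}\to\mathrm{Set}$ and natural transformations between them. -}

module Defs where

open import Level using (Level; 0ℓ; _⊔_) renaming (suc to lsuc)
open import Data.Nat using (ℕ; zero; suc)
open import Data.Fin using (Fin)
open import Data.Vec using (Vec; []; _∷_; tabulate; _∷ʳ_)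
import Data.Vec as Vec
open import Data.List using (List; []; _∷_; _++_; map)
open import Data.List.Membership.Propositional using (_∈_)
open import Data.List.Membership.Propositional.Properties using (∈-map⁺; ∈-++⁺ˡ; ∈-++⁺ʳ)
open import Data.List.Relation.Unary.Any using (here)
open import Relation.Binary.PropositionalEquality using (_≡_; refl)
open import Relation.Binary.Bundles using (Setoid)
open import Function.Bundles using (Func)
open import Data.Product using (Σ)

record Category {o : Level} (Obj : Set o) (ℓ e : Level) : Set (o ⊔ lsuc (ℓ ⊔ e)) where
  infixr 9 _∘_
  infix 4 _≈_
  field
    Hom    : Obj → Obj → Set ℓ
    _≈_    : ∀ {A B} → Hom A B → Hom A B → Set e
    id     : ∀ {A} → Hom A A
    _∘_    : ∀ {A B C} → Hom B C → Hom A B → Hom A C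
    ≈-refl  : ∀ {A B} {f : Hom A B} → f ≈ f
    ≈-sym   : ∀ {A B} {f g : Hom A B} → f ≈ g → g ≈ f
    ≈-trans : ∀ {A B} {f g h : Hom A B} → f ≈ g → g ≈ h → f ≈ h
    ∘-resp-≈ : ∀ {A B C} {f h : Hom B C} {g i : Hom A B} → f ≈ h → g ≈ i → f ∘ g ≈ h ∘ i
    identityˡ : ∀ {A B} {f : Hom A B} → id ∘ f ≈ f
    identityʳ : ∀ {A B} {f : Hom A B} → f ∘ id ≈ f
    assoc     : ∀ {A B C D} {f : Hom A B} {g : Hom B C} {h : Hom C D} →
                (h ∘ g) ∘ f ≈ h ∘ (g ∘ f)

record IsProduct {o ℓ e} {Obj : Set o} (C : Category Obj ℓ e) {A B P : Obj}
                 (p₁ : Category.Hom C P A) (p₂ : Category.Hom C P B) : Set (o ⊔ ℓ ⊔ e) where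
  open Category C
  field
    ⟨_,_⟩  : ∀ {X} → Hom X A → Hom X B → Hom X P
    β₁     : ∀ {X} {f : Hom X A} {g : Hom X B} → p₁ ∘ ⟨ f , g ⟩ ≈ f
    β₂     : ∀ {X} {f : Hom X A} {g : Hom X B} → p₂ ∘ ⟨ f , g ⟩ ≈ g
    unique : ∀ {X} {f : Hom X A} {g : Hom X B} {h : Hom X P} →
             p₁ ∘ h ≈ f → p₂ ∘ h ≈ g → h ≈ ⟨ f , g ⟩

record IsTerminal {o ℓ e} {Obj : Set o} (C : Category Obj ℓ e) (X : Obj) : Set (o ⊔ ℓ ⊔ e) where
  open Category C
  field
    !      : ∀ {Y} → Hom Y X
    !-unique : ∀ {Y} (f : Hom Y X) → f ≈ !

IsProduct-resp : ∀ {o ℓ e} {Obj : Set o} (C : Category Obj ℓ e) {A B P : Obj}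
                 {p₁ q₁ : Category.Hom C P A} {p₂ q₂ : Category.Hom C P B} →
                 Category._≈_ C p₁ q₁ → Category._≈_ C p₂ q₂ →
                 IsProduct C p₁ p₂ → IsProduct C q₁ q₂
IsProduct-resp C e₁ e₂ pr = record
  { ⟨_,_⟩ = ⟨_,_⟩
  ; β₁ = ≈-trans (∘-resp-≈ (≈-sym e₁) ≈-refl) β₁
  ; β₂ = ≈-trans (∘-resp-≈ (≈-sym e₂) ≈-refl) β₂
  ; unique = λ h₁ h₂ → unique (≈-trans (∘-resp-≈ e₁ ≈-refl) h₁) (≈-trans (∘-resp-≈ e₂ ≈-refl) h₂)
  }
  where open Category C
        open IsProduct pr

record Functor {o ℓ e o' ℓ' e'} {O : Set o} {O' : Set o'}
               (C : Category O ℓ e) (D : Category O' ℓ' e')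
               : Set (o ⊔ ℓ ⊔ e ⊔ o' ⊔ ℓ' ⊔ e') where
  private module C = Category C
  private module D = Category D
  field
    F₀ : O → O'
    F₁ : ∀ {A B} → C.Hom A B → D.Hom (F₀ A) (F₀ B)
    F-resp : ∀ {A B} {f g : C.Hom A B} → f C.≈ g → F₁ f D.≈ F₁ g
    F-id   : ∀ {A} → F₁ (C.id {A}) D.≈ D.id
    F-∘    : ∀ {A B C'} {f : C.Hom A B} {g : C.Hom B C'} → F₁ (g C.∘ f) D.≈ F₁ g D.∘ F₁ f

record Adjunction {o ℓ e o' ℓ' e'} {O : Set o} {O' : Set o'}
                  {C : Category O ℓ e} {D : Category O' ℓ' e'}
                  (L : Functor D C) (R : Functor C D)
                  : Set (o ⊔ ℓ ⊔ e ⊔ o' ⊔ ℓ' ⊔ e') where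
  private module C = Category C
  private module D = Category D
  private module L = Functor L
  private module R = Functor R
  field
    φ : ∀ {X Y} → C.Hom (L.F₀ X) Y → D.Hom X (R.F₀ Y)
    ψ : ∀ {X Y} → D.Hom X (R.F₀ Y) → C.Hom (L.F₀ X) Y
    φ-resp : ∀ {X Y} {f g : C.Hom (L.F₀ X) Y} → f C.≈ g → φ f D.≈ φ g
    ψ-resp : ∀ {X Y} {f g : D.Hom X (R.F₀ Y)} → f D.≈ g → ψ f C.≈ ψ g
    φψ : ∀ {X Y} (g : D.Hom X (R.F₀ Y)) → φ (ψ g) D.≈ g
    ψφ : ∀ {X Y} (f : C.Hom (L.F₀ X) Y) → ψ (φ f) C.≈ f
    φ-natural : ∀ {X X' Y Y'} (h : D.Hom X' X) (g : C.Hom Y Y') (f : C.Hom (L.F₀ X) Y) →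
                φ (g C.∘ (f C.∘ L.F₁ h)) D.≈ R.F₁ g D.∘ (φ f D.∘ h)

HasLeftAdjoint : ∀ {o ℓ e o' ℓ' e'} {O : Set o} {O' : Set o'}
                 {C : Category O ℓ e} {D : Category O' ℓ' e'} →
                 Functor C D → Set (o ⊔ ℓ ⊔ e ⊔ o' ⊔ ℓ' ⊔ e')
HasLeftAdjoint {C = C} {D = D} R = Σ (Functor D C) (λ L → Adjunction L R)

-- The category of (small) sets, realised as setoids

SetoidCat : Category (Setoid 0ℓ 0ℓ) 0ℓ 0ℓ
SetoidCat = record
  { Hom = λ A B → Func A B
  ; _≈_ = λ {A} {B} f g → ∀ x → Setoid._≈_ B (Func.to f x) (Func.to g x)
  ; id = λ {A} → record { to = λ x → x ; cong = λ p → p }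
  ; _∘_ = λ g f → record { to = λ x → Func.to g (Func.to f x) ; cong = λ p → Func.cong g (Func.cong f p) }
  ; ≈-refl = λ {A} {B} x → Setoid.refl B
  ; ≈-sym = λ {A} {B} p x → Setoid.sym B (p x)
  ; ≈-trans = λ {A} {B} p q x → Setoid.trans B (p x) (q x)
  ; ∘-resp-≈ = λ {A} {B} {C} {f} {h} {g} {i} p q x → Setoid.trans C (Func.cong f (q x)) (p (Func.to i x))
  ; identityˡ = λ {A} {B} x → Setoid.refl B
  ; identityʳ = λ {A} {B} x → Setoid.refl B
  ; assoc = λ {A} {B} {C} {D} x → Setoid.refl D
  }

-- The category 𝕄 of second-order terms without operators
-- A metavariable context is a list ⟨m₁,…,mₖ⟩ of arities; a metavariable
-- of arity m is a position p : m ∈ Θ.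

Ctx : Set
Ctx = List ℕ

data Tm (Θ : Ctx) (n : ℕ) : Set where
  var  : Fin n → Tm Θ n
  mvar : ∀ {m} → m ∈ Θ → Vec (Tm Θ n) m → Tm Θ n

MHom : Ctx → Ctx → Set
MHom Θ Δ = ∀ {n} → n ∈ Δ → Tm Θ n

_≈M_ : ∀ {Θ Δ} → MHom Θ Δ → MHom Θ Δ → Set
f ≈M g = ∀ {n} (p : n ∈ _) → f p ≡ g p

mutual
  sub : ∀ {Θ m n} → Tm Θ m → Vec (Tm Θ n) m → Tm Θ n
  sub (var x) ρ = Vec.lookup ρ x
  sub (mvar p as) ρ = mvar p (subs as ρ)

  subs : ∀ {Θ m n k} → Vec (Tm Θ m) k → Vec (Tm Θ n) m → Vec (Tm Θ n) k
  subs [] ρ = []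
  subs (a ∷ as) ρ = sub a ρ ∷ subs as ρ

mutual
  msub : ∀ {Λ Θ n} → Tm Θ n → MHom Λ Θ → Tm Λ n
  msub (var x) σ = var x
  msub (mvar p as) σ = sub (σ p) (msubs as σ)

  msubs : ∀ {Λ Θ n k} → Vec (Tm Θ n) k → MHom Λ Θ → Vec (Tm Λ n) k
  msubs [] σ = []
  msubs (a ∷ as) σ = msub a σ ∷ msubs as σ

Mid : ∀ {Θ} → MHom Θ Θ
Mid p = mvar p (tabulate var)

_∘M_ : ∀ {Λ Θ Δ} → MHom Θ Δ → MHom Λ Θ → MHom Λ Δ
(t ∘M s) p = msub (t p) s

-- product projections of 𝕄 (products are concatenation)
Mπ₁ : ∀ A B → MHom (A ++ B) A
Mπ₁ A B p = mvar (∈-++⁺ˡ p) (tabulate var)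

Mπ₂ : ∀ A B → MHom (A ++ B) B
Mπ₂ A B p = mvar (∈-++⁺ʳ A p) (tabulate var)

-- exponential ⟨0⟩ ⇒ ⟨m₁,…,mₖ⟩ = ⟨m₁+1,…,mₖ+1⟩ and its evaluation map
_⁺ : Ctx → Ctx
Γ ⁺ = map suc Γ

Mev : ∀ Γ → MHom (Γ ⁺ ++ (0 ∷ [])) Γ
Mev Γ p = mvar (∈-++⁺ˡ (∈-map⁺ suc p))
               (tabulate var ∷ʳ mvar (∈-++⁺ʳ (Γ ⁺) (here refl)) [])

record Theory : Set₁ where
  field
    𝕋 : Category Ctx 0ℓ 0ℓ
  open Category 𝕋
  field
    -- the identity-on-objects functor T : 𝕄 → 𝕋
    T₁     : ∀ {Θ Δ} → MHom Θ Δ → Hom Θ Δ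
    T-resp : ∀ {Θ Δ} {f g : MHom Θ Δ} → f ≈M g → T₁ f ≈ T₁ g
    T-id   : ∀ {Θ} → T₁ (Mid {Θ}) ≈ id
    T-∘    : ∀ {Λ Θ Δ} {s : MHom Λ Θ} {t : MHom Θ Δ} → T₁ (t ∘M s) ≈ T₁ t ∘ T₁ s
    T-prod : ∀ A B → IsProduct 𝕋 (T₁ (Mπ₁ A B)) (T₁ (Mπ₂ A B))
    T-term : IsTerminal 𝕋 []
  _×id₀ : ∀ {Δ Γ} → Hom Δ Γ → Hom (Δ ++ (0 ∷ [])) (Γ ++ (0 ∷ []))
  _×id₀ {Δ} {Γ} g = IsProduct.⟨_,_⟩ (T-prod Γ (0 ∷ []))
                       (g ∘ T₁ (Mπ₁ Δ (0 ∷ []))) (T₁ (Mπ₂ Δ (0 ∷ [])))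
  field
    -- T preserves the exponentiable object ⟨0⟩:
    -- T(ev) : (⟨0⟩ ⇒ Γ) × ⟨0⟩ → Γ is an exponential in 𝕋
    curry   : ∀ {Γ Δ} → Hom (Δ ++ (0 ∷ [])) Γ → Hom Δ (Γ ⁺)
    curry-β : ∀ {Γ Δ} (f : Hom (Δ ++ (0 ∷ [])) Γ) → T₁ (Mev Γ) ∘ (curry f ×id₀) ≈ f
    curry-unique : ∀ {Γ Δ} (f : Hom (Δ ++ (0 ∷ [])) Γ) (g : Hom Δ (Γ ⁺)) →
                   T₁ (Mev Γ) ∘ (g ×id₀) ≈ f → g ≈ curry f

-- algebraic translations F : T → T' (identity on objects, F ∘ T = T')
record Translation (T T' : Theory) : Set where
  private module T = Theory T
  private module T' = Theory T'
  private module 𝕋 = Category T.𝕋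
  private module 𝕋' = Category T'.𝕋
  field
    F₁     : ∀ {Γ Δ} → 𝕋.Hom Γ Δ → 𝕋'.Hom Γ Δ
    F-resp : ∀ {Γ Δ} {f g : 𝕋.Hom Γ Δ} → f 𝕋.≈ g → F₁ f 𝕋'.≈ F₁ g
    F-id   : ∀ {Γ} → F₁ (𝕋.id {Γ}) 𝕋'.≈ 𝕋'.id
    F-∘    : ∀ {Γ Δ Ε} {f : 𝕋.Hom Γ Δ} {g : 𝕋.Hom Δ Ε} → F₁ (g 𝕋.∘ f) 𝕋'.≈ F₁ g 𝕋'.∘ F₁ f
    F-T    : ∀ {Θ Δ} (f : MHom Θ Δ) → F₁ (T.T₁ f) 𝕋'.≈ T'.T₁ f

record Model (T : Theory) : Set₁ where
  open Theory T
  private module 𝕋 = Category 𝕋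
  private module S = Category SetoidCat
  field
    S₀ : Ctx → Setoid 0ℓ 0ℓ
    S₁ : ∀ {Γ Δ} → 𝕋.Hom Γ Δ → Func (S₀ Γ) (S₀ Δ)
    S-resp : ∀ {Γ Δ} {f g : 𝕋.Hom Γ Δ} → f 𝕋.≈ g → S₁ f S.≈ S₁ g
    S-id   : ∀ {Γ} → S₁ (𝕋.id {Γ}) S.≈ S.id
    S-∘    : ∀ {Γ Δ Ε} {f : 𝕋.Hom Γ Δ} {g : 𝕋.Hom Δ Ε} → S₁ (g 𝕋.∘ f) S.≈ S₁ g S.∘ S₁ f
    S-prod : ∀ A B → IsProduct SetoidCat (S₁ (T₁ (Mπ₁ A B))) (S₁ (T₁ (Mπ₂ A B)))
    S-term : IsTerminal SetoidCat (S₀ [])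

record ModelHom {T : Theory} (S S' : Model T) : Set where
  open Theory T
  private module 𝕋 = Category 𝕋
  private module S = Model S
  private module S' = Model S'
  field
    η : ∀ Γ → Func (S.S₀ Γ) (S'.S₀ Γ)
    natural : ∀ {Γ Δ} (f : 𝕋.Hom Γ Δ) (x : Setoid.Carrier (S.S₀ Γ)) →
              Setoid._≈_ (S'.S₀ Δ) (Func.to (S'.S₁ f) (Func.to (η Γ) x))
                                   (Func.to (η Δ) (Func.to (S.S₁ f) x))

FunMod : (T : Theory) → Category (Model T) 0ℓ 0ℓ
FunMod T = record
  { Hom = ModelHom
  ; _≈_ = λ {S} {S'} α β → ∀ Γ x → Setoid._≈_ (Model.S₀ S' Γ)
                               (Func.to (ModelHom.η α Γ) x) (Func.to (ModelHom.η β Γ) x)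
  ; id = λ {S} → record
      { η = λ Γ → Category.id SetoidCat
      ; natural = λ f x → Setoid.refl (Model.S₀ S _) }
  ; _∘_ = λ {A} {B} {C} β α → record
      { η = λ Γ → Category._∘_ SetoidCat (ModelHom.η β Γ) (ModelHom.η α Γ)
      ; natural = λ {Γ} {Δ} f x → Setoid.trans (Model.S₀ C Δ)
          (ModelHom.natural β f (Func.to (ModelHom.η α Γ) x))
          (Func.cong (ModelHom.η β Δ) (ModelHom.natural α f x)) }
  ; ≈-refl = λ {A} {B} Γ x → Setoid.refl (Model.S₀ B Γ)
  ; ≈-sym = λ {A} {B} p Γ x → Setoid.sym (Model.S₀ B Γ) (p Γ x)
  ; ≈-trans = λ {A} {B} p q Γ x → Setoid.trans (Model.S₀ B Γ) (p Γ x) (q Γ x)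
  ; ∘-resp-≈ = λ {A} {B} {C} {f} {h} {g} {i} p q Γ x → Setoid.trans (Model.S₀ C Γ)
      (Func.cong (ModelHom.η f Γ) (q Γ x)) (p Γ (Func.to (ModelHom.η i Γ) x))
  ; identityˡ = λ {A} {B} Γ x → Setoid.refl (Model.S₀ B Γ)
  ; identityʳ = λ {A} {B} Γ x → Setoid.refl (Model.S₀ B Γ)
  ; assoc = λ {A} {B} {C} {D} Γ x → Setoid.refl (Model.S₀ D Γ)
  }

restrict : {T T' : Theory} → Translation T T' → Model T' → Model T
restrict {T} {T'} F S = record
  { S₀ = S₀
  ; S₁ = λ f → S₁ (F₁ f)
  ; S-resp = λ p → S-resp (F-resp p)
  ; S-id = λ x → Setoid.trans (S₀ _) (S-resp F-id x) (S-id x)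
  ; S-∘ = λ x → Setoid.trans (S₀ _) (S-resp F-∘ x) (S-∘ x)
  ; S-prod = λ A B → IsProduct-resp SetoidCat
      (λ x → Setoid.sym (S₀ A) (S-resp (F-T (Mπ₁ A B)) x))
      (λ x → Setoid.sym (S₀ B) (S-resp (F-T (Mπ₂ A B)) x))
      (S-prod A B)
  ; S-term = S-term
  }
  where open Model S
        open Translation F

AlgebraicFunctor : {T T' : Theory} → Translation T T' → Functor (FunMod T') (FunMod T)
AlgebraicFunctor {T} {T'} F = record
  { F₀ = restrict F
  ; F₁ = λ {S} {S'} α → record
      { η = ModelHom.η α
      ; natural = λ f x → ModelHom.natural α (Translation.F₁ F f) x }
  ; F-resp = λ p → p
  ; F-id = λ {S} Γ x → Setoid.refl (Model.S₀ S Γ)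
  ; F-∘ = λ {A} {B} {C} Γ x → Setoid.refl (Model.S₀ C Γ)
  }

-- The left adjoint is left Kan extension along F, computed pointwise as the coend
-- (Lan M) Γ = ∫^Δ 𝕋'(Δ, Γ) × M Δ: elements g ⊙ x with g : Δ → Γ in 𝕋' and x ∈ M Δ,
-- modulo sliding (g ∘ F f) ⊙ x ~ g ⊙ M f x. A T'-model N receives g ⊙ x ↦ N g (β x)
-- from any β : M → N ∘ F, which is the adjunction. The real content is that Lan M is
-- again cartesian: because F preserves the chosen products, g ⊙ x and h ⊙ y pair to
-- (g × h) ⊙ (x , y) over Δ ++ E, and an element over Δ is recovered from its two
-- projections by sliding along the diagonal Δ → Δ ++ Δ.

module Submission where

open import Defs
open import Level using (Level; 0ℓ)
open import Data.Unit using (tt)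
import Data.Unit.Properties as Unit
open import Data.List using ([]; _++_)
open import Data.Product using (_,_)
open import Relation.Binary.Bundles using (Setoid)
import Relation.Binary.Reasoning.Setoid as SetoidReasoning
open import Function.Bundles using (Func; _⟨$⟩_)
import Function.Construct.Constant as Constant

module CategoryReasoning {o ℓ e : Level} {Obj : Set o} (C : Category Obj ℓ e) where
  open Category C public

  hom-setoid : Obj → Obj → Setoid ℓ e
  hom-setoid A B = record
    { Carrier = Hom A B ; _≈_ = _≈_
    ; isEquivalence = record { refl = ≈-refl ; sym = ≈-sym ; trans = ≈-trans } }

  module _ {A B : Obj} where
    open SetoidReasoning (hom-setoid A B) public

  ∘-resp-≈ˡ : ∀ {A B C} {f h : Hom B C} {g : Hom A B} → f ≈ h → f ∘ g ≈ h ∘ g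
  ∘-resp-≈ˡ p = ∘-resp-≈ p ≈-refl

  ∘-resp-≈ʳ : ∀ {A B C} {f : Hom B C} {g i : Hom A B} → g ≈ i → f ∘ g ≈ f ∘ i
  ∘-resp-≈ʳ p = ∘-resp-≈ ≈-refl p

module Products {o ℓ e : Level} {Obj : Set o} (C : Category Obj ℓ e) {A B P : Obj}
                {p₁ : Category.Hom C P A} {p₂ : Category.Hom C P B}
                (product : IsProduct C p₁ p₂) where
  open CategoryReasoning C
  open IsProduct product public

  ⟨⟩-cong : ∀ {X} {f f' : Hom X A} {g g' : Hom X B} → f ≈ f' → g ≈ g' → ⟨ f , g ⟩ ≈ ⟨ f' , g' ⟩
  ⟨⟩-cong p q = unique (≈-trans β₁ p) (≈-trans β₂ q)

  ⟨⟩-∘ : ∀ {X Y} {f : Hom X A} {g : Hom X B} {h : Hom Y X} → ⟨ f , g ⟩ ∘ h ≈ ⟨ f ∘ h , g ∘ h ⟩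
  ⟨⟩-∘ = unique (≈-trans (≈-sym assoc) (∘-resp-≈ˡ β₁)) (≈-trans (≈-sym assoc) (∘-resp-≈ˡ β₂))

  ⟨⟩-η : ∀ {X} {h : Hom X P} → h ≈ ⟨ p₁ ∘ h , p₂ ∘ h ⟩
  ⟨⟩-η = unique ≈-refl ≈-refl

global-element : ∀ {X : Setoid 0ℓ 0ℓ} → Setoid.Carrier X → Func Unit.≡-setoid X
global-element {X} = Constant.function Unit.≡-setoid X

module SetoidProduct {A B P : Setoid 0ℓ 0ℓ} {p₁ : Func P A} {p₂ : Func P B}
                     (product : IsProduct SetoidCat p₁ p₂) where
  open IsProduct product
  private
    module A = Setoid A
    module B = Setoid B
    module P = Setoid P

  ⟨_,_⟩ₑ : A.Carrier → B.Carrier → P.Carrier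
  ⟨ a , b ⟩ₑ = ⟨ global-element a , global-element b ⟩ ⟨$⟩ tt

  ⟨⟩ₑ-β₁ : ∀ a b → p₁ ⟨$⟩ ⟨ a , b ⟩ₑ A.≈ a
  ⟨⟩ₑ-β₁ a b = β₁ {f = global-element a} {g = global-element b} tt

  ⟨⟩ₑ-β₂ : ∀ a b → p₂ ⟨$⟩ ⟨ a , b ⟩ₑ B.≈ b
  ⟨⟩ₑ-β₂ a b = β₂ {f = global-element a} {g = global-element b} tt

  ⟨⟩ₑ-unique : ∀ {z a b} → p₁ ⟨$⟩ z A.≈ a → p₂ ⟨$⟩ z B.≈ b → z P.≈ ⟨ a , b ⟩ₑ
  ⟨⟩ₑ-unique {z} p q = unique {h = global-element z} (λ _ → p) (λ _ → q) tt

  ⟨⟩ₑ-cong : ∀ {a a' b b'} → a A.≈ a' → b B.≈ b' → ⟨ a , b ⟩ₑ P.≈ ⟨ a' , b' ⟩ₑ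
  ⟨⟩ₑ-cong p q = ⟨⟩ₑ-unique (A.trans (⟨⟩ₑ-β₁ _ _) p) (B.trans (⟨⟩ₑ-β₂ _ _) q)

terminal-setoid-≈ : ∀ {X : Setoid 0ℓ 0ℓ} → IsTerminal SetoidCat X → ∀ a b → Setoid._≈_ X a b
terminal-setoid-≈ {X} terminal a b =
  Setoid.trans X (!-unique (global-element a) tt) (Setoid.sym X (!-unique (global-element b) tt))
  where open IsTerminal terminal

module Cartesian (T : Theory) where
  open Theory T using (𝕋; T₁; T-prod)
  open CategoryReasoning 𝕋 public

  π₁ : ∀ A B → Hom (A ++ B) A
  π₁ A B = T₁ (Mπ₁ A B)

  π₂ : ∀ A B → Hom (A ++ B) B
  π₂ A B = T₁ (Mπ₂ A B)

  module _ {A B : Ctx} where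
    open Products 𝕋 (T-prod A B) public using (⟨_,_⟩; β₁; β₂; unique; ⟨⟩-cong; ⟨⟩-∘; ⟨⟩-η)

  infixr 7 _⊗_
  _⊗_ : ∀ {A A' B B'} → Hom A A' → Hom B B' → Hom (A ++ B) (A' ++ B')
  _⊗_ {A} {B = B} f g = ⟨ f ∘ π₁ A B , g ∘ π₂ A B ⟩

  ⊗-cong : ∀ {A A' B B'} {f f' : Hom A A'} {g g' : Hom B B'} → f ≈ f' → g ≈ g' → f ⊗ g ≈ f' ⊗ g'
  ⊗-cong p q = ⟨⟩-cong (∘-resp-≈ˡ p) (∘-resp-≈ˡ q)

  ⊗-∘-⟨⟩ : ∀ {X A A' B B'} {f : Hom A A'} {g : Hom B B'} {u : Hom X A} {v : Hom X B} →
           (f ⊗ g) ∘ ⟨ u , v ⟩ ≈ ⟨ f ∘ u , g ∘ v ⟩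
  ⊗-∘-⟨⟩ = ≈-trans ⟨⟩-∘ (⟨⟩-cong (≈-trans assoc (∘-resp-≈ʳ β₁)) (≈-trans assoc (∘-resp-≈ʳ β₂)))

  ⊗-∘ : ∀ {A A' A'' B B' B''} {f : Hom A' A''} {g : Hom B' B''} {f' : Hom A A'} {g' : Hom B B'} →
        (f ⊗ g) ∘ (f' ⊗ g') ≈ (f ∘ f') ⊗ (g ∘ g')
  ⊗-∘ = ≈-trans ⊗-∘-⟨⟩ (⟨⟩-cong (≈-sym assoc) (≈-sym assoc))

module TranslationProducts {T T' : Theory} (F : Translation T T') where
  private
    module 𝕋 = Cartesian T
    module 𝕋' = Cartesian T'
  open Translation F

  F-π₁ : ∀ A B → F₁ (𝕋.π₁ A B) 𝕋'.≈ 𝕋'.π₁ A B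
  F-π₁ A B = F-T (Mπ₁ A B)

  F-π₂ : ∀ A B → F₁ (𝕋.π₂ A B) 𝕋'.≈ 𝕋'.π₂ A B
  F-π₂ A B = F-T (Mπ₂ A B)

  F-⟨⟩ : ∀ {X A B} {u : 𝕋.Hom X A} {v : 𝕋.Hom X B} → F₁ 𝕋.⟨ u , v ⟩ 𝕋'.≈ 𝕋'.⟨ F₁ u , F₁ v ⟩
  F-⟨⟩ {A = A} {B} {u} {v} = 𝕋'.unique (F-projection (F-π₁ A B) 𝕋.β₁) (F-projection (F-π₂ A B) 𝕋.β₂)
    where
      F-projection : ∀ {X Y Z} {p : 𝕋.Hom Y Z} {p' : 𝕋'.Hom Y Z} {h : 𝕋.Hom X Y} {w : 𝕋.Hom X Z} →
                     F₁ p 𝕋'.≈ p' → p 𝕋.∘ h 𝕋.≈ w → p' 𝕋'.∘ F₁ h 𝕋'.≈ F₁ w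
      F-projection {p = p} {p'} {h} {w} Fp ph = 𝕋'.begin
        p' 𝕋'.∘ F₁ h    𝕋'.≈⟨ 𝕋'.∘-resp-≈ˡ Fp ⟨
        F₁ p 𝕋'.∘ F₁ h  𝕋'.≈⟨ F-∘ ⟨
        F₁ (p 𝕋.∘ h)    𝕋'.≈⟨ F-resp ph ⟩
        F₁ w            𝕋'.∎

  F-⊗ : ∀ {A A' B B'} {f : 𝕋.Hom A A'} {g : 𝕋.Hom B B'} → F₁ (f 𝕋.⊗ g) 𝕋'.≈ F₁ f 𝕋'.⊗ F₁ g
  F-⊗ {A} {B = B} = 𝕋'.≈-trans F-⟨⟩
    (𝕋'.⟨⟩-cong (𝕋'.≈-trans F-∘ (𝕋'.∘-resp-≈ʳ (F-π₁ A B))) (𝕋'.≈-trans F-∘ (𝕋'.∘-resp-≈ʳ (F-π₂ A B))))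

module ModelProperties {T : Theory} (M : Model T) where
  open Model M
  open Cartesian T using (Hom; _∘_; _≈_; id; π₁; π₂; ⟨_,_⟩; β₁; β₂; _⊗_)

  ∣_∣ : Ctx → Set
  ∣ Γ ∣ = Setoid.Carrier (S₀ Γ)

  Eq : ∀ Γ → ∣ Γ ∣ → ∣ Γ ∣ → Set
  Eq Γ = Setoid._≈_ (S₀ Γ)
  infix 4 Eq
  syntax Eq Γ x y = x ≈[ Γ ] y

  module _ {Γ : Ctx} where
    open SetoidReasoning (S₀ Γ) public
    open Setoid (S₀ Γ) public using () renaming (refl to S-refl; sym to S-sym; trans to S-trans)

  module _ {A B : Ctx} where
    open SetoidProduct (S-prod A B) public

  S₁-square : ∀ {X Y Z} {u : Hom Y Z} {v : Hom X Y} {w : Hom X Z} →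
              u ∘ v ≈ w → ∀ a → S₁ u ⟨$⟩ (S₁ v ⟨$⟩ a) ≈[ Z ] S₁ w ⟨$⟩ a
  S₁-square p a = S-trans (S-sym (S-∘ a)) (S-resp p a)

  S₁-⟨⟩ : ∀ {X A B} {u : Hom X A} {v : Hom X B} z →
          S₁ ⟨ u , v ⟩ ⟨$⟩ z ≈[ A ++ B ] ⟨ S₁ u ⟨$⟩ z , S₁ v ⟨$⟩ z ⟩ₑ
  S₁-⟨⟩ z = ⟨⟩ₑ-unique (S₁-square β₁ z) (S₁-square β₂ z)

  S₁-⊗ : ∀ {A A' B B'} {f : Hom A A'} {g : Hom B B'} x y →
         S₁ (f ⊗ g) ⟨$⟩ ⟨ x , y ⟩ₑ ≈[ A' ++ B' ] ⟨ S₁ f ⟨$⟩ x , S₁ g ⟨$⟩ y ⟩ₑ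
  S₁-⊗ {f = f} {g} x y = begin
    S₁ (f ⊗ g) ⟨$⟩ ⟨ x , y ⟩ₑ
      ≈⟨ S₁-⟨⟩ _ ⟩
    ⟨ S₁ (f ∘ π₁ _ _) ⟨$⟩ ⟨ x , y ⟩ₑ , S₁ (g ∘ π₂ _ _) ⟨$⟩ ⟨ x , y ⟩ₑ ⟩ₑ
      ≈⟨ ⟨⟩ₑ-cong (S-trans (S-∘ _) (Func.cong (S₁ f) (⟨⟩ₑ-β₁ x y)))
                  (S-trans (S-∘ _) (Func.cong (S₁ g) (⟨⟩ₑ-β₂ x y))) ⟩
    ⟨ S₁ f ⟨$⟩ x , S₁ g ⟨$⟩ y ⟩ₑ
      ∎

  S₁-diagonal : ∀ {A} x → S₁ ⟨ id {A} , id ⟩ ⟨$⟩ x ≈[ A ++ A ] ⟨ x , x ⟩ₑ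
  S₁-diagonal x = S-trans (S₁-⟨⟩ x) (⟨⟩ₑ-cong (S-id x) (S-id x))

  point : ∣ [] ∣
  point = IsTerminal.! S-term {Unit.≡-setoid} ⟨$⟩ tt

  S₀[]-≈ : ∀ a b → a ≈[ [] ] b
  S₀[]-≈ = terminal-setoid-≈ S-term

module LeftKanExtension {T T' : Theory} (F : Translation T T') where
  private
    module 𝕋 = Cartesian T
    module 𝕋' = Cartesian T'
  open Translation F using (F₁; F-id)
  open TranslationProducts F

  module Extension (M : Model T) where
    open Model M using (S₀; S₁; S-id)
    open ModelProperties M

    infix 5 _⊙_
    record Elt (Γ : Ctx) : Set where
      constructor _⊙_
      field
        {dom} : Ctx
        arr   : 𝕋'.Hom dom Γ
        pt    : ∣ dom ∣

    infix 4 _~_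
    data _~_ {Γ : Ctx} : Elt Γ → Elt Γ → Set where
      ⊙-cong  : ∀ {Δ} {g g' : 𝕋'.Hom Δ Γ} {x x'} → g 𝕋'.≈ g' → x ≈[ Δ ] x' → g ⊙ x ~ g' ⊙ x'
      slide   : ∀ {Δ Δ'} (f : 𝕋.Hom Δ Δ') (g : 𝕋'.Hom Δ' Γ) x →
                (g 𝕋'.∘ F₁ f) ⊙ x ~ g ⊙ (S₁ f ⟨$⟩ x)
      ~-sym   : ∀ {a b} → a ~ b → b ~ a
      ~-trans : ∀ {a b c} → a ~ b → b ~ c → a ~ c

    ~-refl : ∀ {Γ} {a : Elt Γ} → a ~ a
    ~-refl {a = g ⊙ x} = ⊙-cong 𝕋'.≈-refl S-refl

    L₀ : Ctx → Setoid 0ℓ 0ℓ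
    L₀ Γ = record
      { Carrier = Elt Γ ; _≈_ = _~_
      ; isEquivalence = record { refl = ~-refl ; sym = ~-sym ; trans = ~-trans } }

    module _ {Γ : Ctx} (B : Setoid 0ℓ 0ℓ) (h : Elt Γ → Setoid.Carrier B)
             (h-cong : ∀ {Δ} {g g' : 𝕋'.Hom Δ Γ} {x x'} → g 𝕋'.≈ g' → x ≈[ Δ ] x' →
                       Setoid._≈_ B (h (g ⊙ x)) (h (g' ⊙ x')))
             (h-slide : ∀ {Δ Δ'} (f : 𝕋.Hom Δ Δ') (g : 𝕋'.Hom Δ' Γ) x →
                        Setoid._≈_ B (h ((g 𝕋'.∘ F₁ f) ⊙ x)) (h (g ⊙ (S₁ f ⟨$⟩ x))))
             where
      lift : Func (L₀ Γ) B
      lift = record { to = h ; cong = respects }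
        where
          respects : ∀ {a b} → a ~ b → Setoid._≈_ B (h a) (h b)
          respects (⊙-cong p q)    = h-cong p q
          respects (slide f g x)   = h-slide f g x
          respects (~-sym p)       = Setoid.sym B (respects p)
          respects (~-trans p q)   = Setoid.trans B (respects p) (respects q)

    L₁ : ∀ {Γ Γ'} → 𝕋'.Hom Γ Γ' → Func (L₀ Γ) (L₀ Γ')
    L₁ f = lift (L₀ _) (λ { (g ⊙ x) → (f 𝕋'.∘ g) ⊙ x })
      (λ p q → ⊙-cong (𝕋'.∘-resp-≈ʳ p) q)
      (λ f' g x → ~-trans (⊙-cong (𝕋'.≈-sym 𝕋'.assoc) S-refl) (slide f' (f 𝕋'.∘ g) x))

    pair : ∀ {A B} → Elt A → Elt B → Elt (A ++ B)
    pair (g ⊙ x) (h ⊙ y) = (g 𝕋'.⊗ h) ⊙ ⟨ x , y ⟩ₑ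

    pair-⊙-cong : ∀ {A B Δ E} {g g' : 𝕋'.Hom Δ A} {h h' : 𝕋'.Hom E B} {x x' y y'} →
                  g 𝕋'.≈ g' → x ≈[ Δ ] x' → h 𝕋'.≈ h' → y ≈[ E ] y' →
                  pair (g ⊙ x) (h ⊙ y) ~ pair (g' ⊙ x') (h' ⊙ y')
    pair-⊙-cong p q r s = ⊙-cong (𝕋'.⊗-cong p r) (⟨⟩ₑ-cong q s)

    -- Sliding both components at once is a single slide along f ⊗ f', since F preserves ⊗.
    pair-slide : ∀ {A B Δ Δ' E E'} (f : 𝕋.Hom Δ Δ') (f' : 𝕋.Hom E E')
                 (g : 𝕋'.Hom Δ' A) (h : 𝕋'.Hom E' B) x y →
                 pair ((g 𝕋'.∘ F₁ f) ⊙ x) ((h 𝕋'.∘ F₁ f') ⊙ y) ~ pair (g ⊙ (S₁ f ⟨$⟩ x)) (h ⊙ (S₁ f' ⟨$⟩ y))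
    pair-slide f f' g h x y =
      ~-trans (⊙-cong arrows S-refl)
        (~-trans (slide (f 𝕋.⊗ f') (g 𝕋'.⊗ h) ⟨ x , y ⟩ₑ) (⊙-cong 𝕋'.≈-refl (S₁-⊗ x y)))
      where
        arrows : (g 𝕋'.∘ F₁ f) 𝕋'.⊗ (h 𝕋'.∘ F₁ f') 𝕋'.≈ (g 𝕋'.⊗ h) 𝕋'.∘ F₁ (f 𝕋.⊗ f')
        arrows = 𝕋'.≈-sym (𝕋'.≈-trans (𝕋'.∘-resp-≈ʳ F-⊗) 𝕋'.⊗-∘)

    ∘-F-id : ∀ {Δ Γ} (g : 𝕋'.Hom Δ Γ) → g 𝕋'.∘ F₁ 𝕋.id 𝕋'.≈ g
    ∘-F-id g = 𝕋'.≈-trans (𝕋'.∘-resp-≈ʳ F-id) 𝕋'.identityʳ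

    pair-congˡ : ∀ {A B} {a a' : Elt A} (b : Elt B) → a ~ a' → pair a b ~ pair a' b
    pair-congˡ (h ⊙ y) = Func.cong (lift (L₀ _) (λ a → pair a (h ⊙ y))
      (λ p q → pair-⊙-cong p q 𝕋'.≈-refl S-refl)
      (λ f g x → ~-trans (pair-⊙-cong 𝕋'.≈-refl S-refl (𝕋'.≈-sym (∘-F-id h)) S-refl)
        (~-trans (pair-slide f 𝕋.id g h x y)
          (pair-⊙-cong 𝕋'.≈-refl S-refl 𝕋'.≈-refl (S-id y)))))

    pair-congʳ : ∀ {A B} (a : Elt A) {b b' : Elt B} → b ~ b' → pair a b ~ pair a b'
    pair-congʳ (g ⊙ x) = Func.cong (lift (L₀ _) (λ b → pair (g ⊙ x) b)
      (λ p q → pair-⊙-cong 𝕋'.≈-refl S-refl p q)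
      (λ f h y → ~-trans (pair-⊙-cong (𝕋'.≈-sym (∘-F-id g)) S-refl 𝕋'.≈-refl S-refl)
        (~-trans (pair-slide 𝕋.id f g h x y)
          (pair-⊙-cong 𝕋'.≈-refl (S-id x) 𝕋'.≈-refl S-refl))))

    pair-cong : ∀ {A B} {a a' : Elt A} {b b' : Elt B} → a ~ a' → b ~ b' → pair a b ~ pair a' b'
    pair-cong {b = b} p q = ~-trans (pair-congˡ b p) (pair-congʳ _ q)

    pair-β₁ : ∀ {A B} (a : Elt A) (b : Elt B) → L₁ (𝕋'.π₁ A B) ⟨$⟩ pair a b ~ a
    pair-β₁ (g ⊙ x) (h ⊙ y) =
      ~-trans (⊙-cong (𝕋'.≈-trans 𝕋'.β₁ (𝕋'.∘-resp-≈ʳ (𝕋'.≈-sym (F-π₁ _ _)))) S-refl)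
        (~-trans (slide (𝕋.π₁ _ _) g ⟨ x , y ⟩ₑ) (⊙-cong 𝕋'.≈-refl (⟨⟩ₑ-β₁ x y)))

    pair-β₂ : ∀ {A B} (a : Elt A) (b : Elt B) → L₁ (𝕋'.π₂ A B) ⟨$⟩ pair a b ~ b
    pair-β₂ (g ⊙ x) (h ⊙ y) =
      ~-trans (⊙-cong (𝕋'.≈-trans 𝕋'.β₂ (𝕋'.∘-resp-≈ʳ (𝕋'.≈-sym (F-π₂ _ _)))) S-refl)
        (~-trans (slide (𝕋.π₂ _ _) h ⟨ x , y ⟩ₑ) (⊙-cong 𝕋'.≈-refl (⟨⟩ₑ-β₂ x y)))

    pair-η : ∀ {A B} (z : Elt (A ++ B)) → z ~ pair (L₁ (𝕋'.π₁ A B) ⟨$⟩ z) (L₁ (𝕋'.π₂ A B) ⟨$⟩ z)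
    pair-η {A} {B} (g ⊙ x) =
      ~-trans (⊙-cong arrows S-refl) (~-trans (slide 𝕋.⟨ 𝕋.id , 𝕋.id ⟩ _ x) (⊙-cong 𝕋'.≈-refl (S₁-diagonal x)))
      where
        g₁ : 𝕋'.Hom _ A
        g₁ = 𝕋'.π₁ A B 𝕋'.∘ g
        g₂ : 𝕋'.Hom _ B
        g₂ = 𝕋'.π₂ A B 𝕋'.∘ g
        arrows : g 𝕋'.≈ (g₁ 𝕋'.⊗ g₂) 𝕋'.∘ F₁ 𝕋.⟨ 𝕋.id , 𝕋.id ⟩
        arrows = 𝕋'.begin
          g                                            𝕋'.≈⟨ 𝕋'.⟨⟩-η ⟩
          𝕋'.⟨ g₁ , g₂ ⟩                              𝕋'.≈⟨ 𝕋'.⟨⟩-cong (∘-F-id g₁) (∘-F-id g₂) ⟨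
          𝕋'.⟨ g₁ 𝕋'.∘ F₁ 𝕋.id , g₂ 𝕋'.∘ F₁ 𝕋.id ⟩  𝕋'.≈⟨ 𝕋'.⊗-∘-⟨⟩ ⟨
          (g₁ 𝕋'.⊗ g₂) 𝕋'.∘ 𝕋'.⟨ F₁ 𝕋.id , F₁ 𝕋.id ⟩  𝕋'.≈⟨ 𝕋'.∘-resp-≈ʳ F-⟨⟩ ⟨
          (g₁ 𝕋'.⊗ g₂) 𝕋'.∘ F₁ 𝕋.⟨ 𝕋.id , 𝕋.id ⟩     𝕋'.∎

    L-prod : ∀ A B → IsProduct SetoidCat (L₁ (𝕋'.π₁ A B)) (L₁ (𝕋'.π₂ A B))
    L-prod A B = record
      { ⟨_,_⟩ = λ f₁ f₂ → record { to = λ z → pair (f₁ ⟨$⟩ z) (f₂ ⟨$⟩ z)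
                                 ; cong = λ p → pair-cong (Func.cong f₁ p) (Func.cong f₂ p) }
      ; β₁ = λ {_} {f₁} {f₂} z → pair-β₁ (f₁ ⟨$⟩ z) (f₂ ⟨$⟩ z)
      ; β₂ = λ {_} {f₁} {f₂} z → pair-β₂ (f₁ ⟨$⟩ z) (f₂ ⟨$⟩ z)
      ; unique = λ {_} {_} {_} {h} p q z → ~-trans (pair-η (h ⟨$⟩ z)) (pair-cong (p z) (q z))
      }

    L-term : IsTerminal SetoidCat (L₀ [])
    L-term = record
      { ! = Constant.function _ (L₀ []) (𝕋'.id ⊙ point)
      ; !-unique = λ f z → collapse (f ⟨$⟩ z)
      }
      where
        open IsTerminal (Theory.T-term T') using (!-unique)
        collapse : (a : Elt []) → a ~ 𝕋'.id ⊙ point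
        collapse (g ⊙ x) =
          ~-trans (⊙-cong (𝕋'.≈-trans (!-unique g) (𝕋'.≈-sym (!-unique _))) S-refl)
            (~-trans (slide (IsTerminal.! (Theory.T-term T)) 𝕋'.id x) (⊙-cong 𝕋'.≈-refl (S₀[]-≈ _ _)))

    L : Model T'
    L = record
      { S₀ = L₀
      ; S₁ = L₁
      ; S-resp = λ { p (g ⊙ x) → ⊙-cong (𝕋'.∘-resp-≈ˡ p) S-refl }
      ; S-id = λ { (g ⊙ x) → ⊙-cong 𝕋'.identityˡ S-refl }
      ; S-∘ = λ { (g ⊙ x) → ⊙-cong 𝕋'.assoc S-refl }
      ; S-prod = L-prod
      ; S-term = L-term
      }

  open Extension using (_⊙_; ⊙-cong; slide; ~-trans; ~-refl)

  Lan₁ : ∀ {M M'} → ModelHom M M' → ModelHom (Extension.L M) (Extension.L M')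
  Lan₁ {M} {M'} α = record
    { η = λ Γ → Extension.lift M (Extension.L₀ M' Γ) (λ { (g ⊙ x) → g ⊙ (η _ ⟨$⟩ x) })
        (λ p q → ⊙-cong p (Func.cong (η _) q))
        (λ f g x → ~-trans (slide f g _) (⊙-cong 𝕋'.≈-refl (natural f x)))
    ; natural = λ _ _ → ~-refl M'
    }
    where open ModelHom α

  Lan : Functor (FunMod T) (FunMod T')
  Lan = record
    { F₀ = Extension.L
    ; F₁ = Lan₁
    ; F-resp = λ p _ → λ { (g ⊙ x) → ⊙-cong 𝕋'.≈-refl (p _ x) }
    ; F-id = λ {M} _ _ → ~-refl M
    ; F-∘ = λ {_} {_} {M} _ _ → ~-refl M
    }

  module _ {M : Model T} {N : Model T'} where
    private
      module M = Model M
      module N = Model N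
    open ModelProperties N using (S-sym; S-trans)

    transpose : ModelHom (Extension.L M) N → ModelHom M (restrict F N)
    transpose α = record
      { η = λ Γ → record { to = λ x → η Γ ⟨$⟩ (𝕋'.id ⊙ x)
                         ; cong = λ p → Func.cong (η Γ) (⊙-cong 𝕋'.≈-refl p) }
      ; natural = λ {Γ} {Δ} f x → S-trans (natural (F₁ f) (𝕋'.id ⊙ x))
          (Func.cong (η Δ) (~-trans (⊙-cong (𝕋'.≈-trans 𝕋'.identityʳ (𝕋'.≈-sym 𝕋'.identityˡ)) (Setoid.refl (M.S₀ Γ)))
                                     (slide f 𝕋'.id x)))
      }
      where open ModelHom α

    untranspose : ModelHom M (restrict F N) → ModelHom (Extension.L M) N
    untranspose β = record
      { η = λ Γ → Extension.lift M (N.S₀ Γ) (λ { (g ⊙ x) → N.S₁ g ⟨$⟩ (η _ ⟨$⟩ x) })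
          (λ {_} {_} {g'} p q → S-trans (N.S-resp p _) (Func.cong (N.S₁ g') (Func.cong (η _) q)))
          (λ f g x → S-trans (N.S-∘ _) (Func.cong (N.S₁ g) (natural f x)))
      ; natural = λ _ _ → S-sym (N.S-∘ _)
      }
      where open ModelHom β

  adjunction : Adjunction Lan (AlgebraicFunctor F)
  adjunction = record
    { φ = transpose
    ; ψ = untranspose
    ; φ-resp = λ p Γ x → p Γ (𝕋'.id ⊙ x)
    ; ψ-resp = λ {_} {N} p _ → λ { (g ⊙ x) → Func.cong (Model.S₁ N g) (p _ x) }
    ; φψ = λ {_} {N} _ _ _ → Model.S-id N _
    ; ψφ = λ {M} {N} α Γ → λ { (g ⊙ x) → Setoid.trans (Model.S₀ N Γ)
        (ModelHom.natural α g (𝕋'.id ⊙ x))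
        (Func.cong (ModelHom.η α Γ) (⊙-cong 𝕋'.identityʳ (Setoid.refl (Model.S₀ M _)))) }
    ; φ-natural = λ {_} {_} {_} {N} _ _ _ Γ _ → Setoid.refl (Model.S₀ N Γ)
    }

theorem5 : (T T' : Theory) (F : Translation T T') → HasLeftAdjoint (AlgebraicFunctor F)
theorem5 T T' F = Lan , adjunction
  where open LeftKanExtension F
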